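{- The class of chain graphs is degree sandwich monotone; that is, for every chain graph $G$ and every set $F\subseteq E(G)$ such that $G-F$ is a chain graph, every degree-minimal edge $e$ in $F$ satisfies that $G-e$ is a chain graph.
   Context: A chain graph is a bipartite graph whose vertex set can be partitioned into two independent sets $X$ and $Y$ such that the neighborhoods of the vertices in $X$ are linearly ordered by inclusion. For $F\subseteq E(G)$, an edge $uv\in F$ is degree-minimal in $F$ if (i) $u$ has the smallest degree in $G$ among all vertices incident to an edge of $F$, and (ii) $d_G(v)$ is smallest among all vertices $w$ with $uw\in F$. -}

module Defs where

open import Data.Nat using (ℕ; _≤_)
open import Data.Bool using (Bool; true; false; _∧_; _∨_; not; if_then_else_)
open import Data.Fin using (Fin; _≟_)
open import Data.List using (allFin; map)
open import Data.Nat.ListAction using (sum)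
open import Data.Product using (Σ; _×_)
open import Data.Sum using (_⊎_)
open import Relation.Nullary using (¬_)
open import Relation.Nullary.Decidable using (⌊_⌋)
open import Relation.Binary.PropositionalEquality using (_≡_; _≢_; cong₂)

record Graph (n : ℕ) : Set where
  field
    adj     : Fin n → Fin n → Bool
    adj-sym : ∀ u v → adj u v ≡ adj v u
    adj-irr : ∀ u → adj u u ≡ false
open Graph public

deg : ∀ {n} → Graph n → Fin n → ℕ
deg {n} G v = sum (map (λ w → if adj G v w then 1 else 0) (allFin n))

IsEdgeSet : ∀ {n} → Graph n → (Fin n → Fin n → Bool) → Set
IsEdgeSet {n} G F = (∀ u v → F u v ≡ F v u) × (∀ u v → F u v ≡ true → adj G u v ≡ true)

delete : ∀ {n} (G : Graph n) (F : Fin n → Fin n → Bool) →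
         (∀ u v → F u v ≡ F v u) → Graph n
delete G F Fsym = record
  { adj     = λ u v → adj G u v ∧ not (F u v)
  ; adj-sym = λ u v → cong₂ (λ a b → a ∧ not b) (adj-sym G u v) (Fsym u v)
  ; adj-irr = λ u → irr u
  }
  where
  irr : ∀ u → adj G u u ∧ not (F u u) ≡ false
  irr u rewrite adj-irr G u = _≡_.refl

single : ∀ {n} → Fin n → Fin n → Fin n → Fin n → Bool
single u v x y = (⌊ x ≟ u ⌋ ∧ ⌊ y ≟ v ⌋) ∨ (⌊ x ≟ v ⌋ ∧ ⌊ y ≟ u ⌋)

single-sym : ∀ {n} (u v : Fin n) → ∀ x y → single u v x y ≡ single u v y x
single-sym u v x y with ⌊ x ≟ u ⌋ | ⌊ y ≟ v ⌋ | ⌊ x ≟ v ⌋ | ⌊ y ≟ u ⌋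
... | false | false | false | false = _≡_.refl
... | false | false | false | true  = _≡_.refl
... | false | false | true  | false = _≡_.refl
... | false | false | true  | true  = _≡_.refl
... | false | true  | false | false = _≡_.refl
... | false | true  | false | true  = _≡_.refl
... | false | true  | true  | false = _≡_.refl
... | false | true  | true  | true  = _≡_.refl
... | true  | false | false | false = _≡_.refl
... | true  | false | false | true  = _≡_.refl
... | true  | false | true  | false = _≡_.refl
... | true  | false | true  | true  = _≡_.refl
... | true  | true  | false | false = _≡_.refl
... | true  | true  | false | true  = _≡_.refl
... | true  | true  | true  | false = _≡_.refl
... | true  | true  | true  | true  = _≡_.refl

deleteEdge : ∀ {n} → Graph n → Fin n → Fin n → Graph n
deleteEdge G u v = delete G (single u v) (single-sym u v)

NbhdSub : ∀ {n} → Graph n → Fin n → Fin n → Set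
NbhdSub {n} G x y = ∀ (w : Fin n) → adj G x w ≡ true → adj G y w ≡ true

-- Chain graph: the vertex set splits into X (X v ≡ true) and Y (X v ≡ false),
-- both independent (every edge joins X and Y), and the neighbourhoods of the
-- vertices in X are linearly ordered by inclusion.
IsChainGraph : ∀ {n} → Graph n → Set
IsChainGraph {n} G = Σ (Fin n → Bool) λ X →
    (∀ u v → adj G u v ≡ true → X u ≢ X v)
  × (∀ x y → X x ≡ true → X y ≡ true → NbhdSub G x y ⊎ NbhdSub G y x)

DegreeMinimal : ∀ {n} → Graph n → (Fin n → Fin n → Bool) → Fin n → Fin n → Set
DegreeMinimal {n} G F u v =
    F u v ≡ true
  × (∀ w z → F w z ≡ true → deg G u ≤ deg G w × deg G u ≤ deg G z)
  × (∀ w → F u w ≡ true → deg G v ≤ deg G w)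

{-# OPTIONS --safe #-}
module Submission where

open import Defs
open import Data.Nat using (ℕ; _≤_; _<_; z≤n; s≤s)
open import Data.Nat.Properties using (≤-refl; +-mono-≤; +-mono-<-≤; +-mono-≤-<; <⇒≱)
open import Data.Bool using (Bool; true; false; if_then_else_)
open import Data.Bool.Properties using (¬-not)
open import Data.Fin using (Fin; _≟_)
open import Data.Fin.Properties using (all?; ¬∀⟶∃¬)
open import Data.List using ([]; _∷_; map)
open import Data.List.Relation.Unary.Any using (here; there)
open import Data.List.Membership.Propositional using (_∈_)
open import Data.List.Membership.Propositional.Properties using (∈-allFin)
open import Data.Nat.ListAction using (sum)
open import Data.Product using (∃; _×_; _,_; proj₁; proj₂)
open import Data.Sum using (_⊎_; inj₁; inj₂)
open import Data.Empty using (⊥; ⊥-elim)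
open import Relation.Nullary using (¬_; Dec; yes; no)
open import Relation.Binary.PropositionalEquality using (_≡_; _≢_; refl; sym; trans)

-- Delete uv from G, keeping the bipartition X. If two X-vertices x, a became
-- incomparable, then, say, N(x) ⊆ N(a) in G, and incomparability in G − uv is
-- witnessed by b ∈ N(x) with ab = uv and c ∈ N(a) ∖ N(x). Then N(x) ⊊ N(a) and
-- N(c) ⊊ N(b), so deg x < deg a and deg c < deg b; degree-minimality of uv
-- therefore keeps xb and ac out of F, and xb, ac form an induced 2K₂ in G − F,
-- which no chain graph contains.

true≢false : true ≢ false
true≢false ()

other-side-false : ∀ {a b : Bool} → a ≢ b → a ≡ true → b ≡ false
other-side-false {b = false} _   _    = refl
other-side-false {b = true}  a≢b refl = ⊥-elim (a≢b refl)

other-side-true : ∀ {a b : Bool} → a ≢ b → a ≡ false → b ≡ true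
other-side-true {b = true}  _   _    = refl
other-side-true {b = false} a≢b refl = ⊥-elim (a≢b refl)

one-side-true : ∀ {a b : Bool} → a ≢ b → a ≡ true ⊎ b ≡ true
one-side-true {true}  _ = inj₁ refl
one-side-true {false} {true} _ = inj₂ refl
one-side-true {false} {false} a≢b = ⊥-elim (a≢b refl)

implies? : (a b : Bool) → Dec (a ≡ true → b ≡ true)
implies? true  true  = yes λ _ → refl
implies? true  false = no λ a⇒b → true≢false (sym (a⇒b refl))
implies? false _     = yes λ ()

¬implies : ∀ {a b : Bool} → ¬ (a ≡ true → b ≡ true) → a ≡ true × b ≡ false
¬implies {true}  {false} _ = refl , refl
¬implies {true}  {true}  ¬a⇒b = ⊥-elim (¬a⇒b λ _ → refl)
¬implies {false}         ¬a⇒b = ⊥-elim (¬a⇒b λ ())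

module _ {a} {A : Set a} {f g : A → ℕ} (f≤g : ∀ w → f w ≤ g w) where

  sum-map-mono : ∀ xs → sum (map f xs) ≤ sum (map g xs)
  sum-map-mono []       = z≤n
  sum-map-mono (x ∷ xs) = +-mono-≤ (f≤g x) (sum-map-mono xs)

  sum-map-< : ∀ {w xs} → w ∈ xs → f w < g w → sum (map f xs) < sum (map g xs)
  sum-map-< {xs = _ ∷ xs} (here refl) fw<gw = +-mono-<-≤ fw<gw (sum-map-mono xs)
  sum-map-< {xs = x ∷ _}  (there w∈xs) fw<gw = +-mono-≤-< (f≤g x) (sum-map-< w∈xs fw<gw)

module _ {n} (G : Graph n) where

  adj-swap : ∀ {a b x} → adj G a b ≡ x → adj G b a ≡ x
  adj-swap {a} {b} ab = trans (adj-sym G b a) ab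

  properNbhdSub⇒deg< : ∀ {x y w} → NbhdSub G x y → adj G y w ≡ true → adj G x w ≡ false →
                       deg G x < deg G y
  properNbhdSub⇒deg< {x} {y} {w} x⊆y yw xw =
    sum-map-< indicator-mono (∈-allFin w) indicator-<
    where
    indicator-mono : ∀ z → (if adj G x z then 1 else 0) ≤ (if adj G y z then 1 else 0)
    indicator-mono z with adj G x z | x⊆y z
    ... | true  | xz⇒yz rewrite xz⇒yz refl = ≤-refl
    ... | false | _ = z≤n
    indicator-< : (if adj G x w then 1 else 0) < (if adj G y w then 1 else 0)
    indicator-< rewrite yw | xw = s≤s z≤n

  nbhdSub? : ∀ x y → Dec (NbhdSub G x y)
  nbhdSub? x y = all? λ w → implies? (adj G x w) (adj G y w)

  ¬nbhdSub⇒witness : ∀ {x y} → ¬ NbhdSub G x y → ∃ λ w → adj G x w ≡ true × adj G y w ≡ false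
  ¬nbhdSub⇒witness {x} {y} x⊈y with ¬∀⟶∃¬ n _ (λ w → implies? (adj G x w) (adj G y w)) x⊈y
  ... | w , ¬xw⇒yw = w , ¬implies ¬xw⇒yw

  comparable-unless-crossing :
    ∀ {x y} → (∀ {b c} → adj G x b ≡ true → adj G y b ≡ false →
                         adj G y c ≡ true → adj G x c ≡ false → ⊥) →
    NbhdSub G x y ⊎ NbhdSub G y x
  comparable-unless-crossing {x} {y} no-crossing with nbhdSub? x y | nbhdSub? y x
  ... | yes x⊆y | _       = inj₁ x⊆y
  ... | no _    | yes y⊆x = inj₂ y⊆x
  ... | no x⊈y  | no y⊈x with ¬nbhdSub⇒witness x⊈y | ¬nbhdSub⇒witness y⊈x
  ...   | b , xb , yb | c , yc , xc = ⊥-elim (no-crossing xb yb yc xc)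

module _ {n} (G : Graph n) (F : Fin n → Fin n → Bool) (Fsym : ∀ x y → F x y ≡ F y x) where

  private
    G∖F = delete G F Fsym

  delete-⊆ : ∀ {a b} → adj G∖F a b ≡ true → adj G a b ≡ true
  delete-⊆ {a} {b} ab with adj G a b
  ... | true  = refl
  ... | false = ab

  delete-adj⁺ : ∀ {a b} → adj G a b ≡ true → F a b ≡ false → adj G∖F a b ≡ true
  delete-adj⁺ {a} {b} ab Fab rewrite ab | Fab = refl

  delete-nonadj : ∀ {a b} → adj G a b ≡ false → adj G∖F a b ≡ false
  delete-nonadj {a} {b} ab rewrite ab = refl

  delete-removes : ∀ {a b} → F a b ≡ true → adj G∖F a b ≡ false
  delete-removes {a} {b} Fab rewrite Fab with adj G a b
  ... | true  = refl
  ... | false = refl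

  delete-nonadj⁻ : ∀ {a b} → adj G∖F a b ≡ false → adj G a b ≡ true → F a b ≡ true
  delete-nonadj⁻ {a} {b} ab∉G∖F ab rewrite ab with F a b
  ... | true  = refl
  ... | false = ⊥-elim (true≢false ab∉G∖F)

module _ {n} {u v : Fin n} where

  single⁻ : ∀ {a b} → single u v a b ≡ true → (a ≡ u × b ≡ v) ⊎ (a ≡ v × b ≡ u)
  single⁻ {a} {b} eq with a ≟ u | b ≟ v | a ≟ v | b ≟ u
  ... | yes a≡u | yes b≡v | _      | _      = inj₁ (a≡u , b≡v)
  ... | _       | _       | yes a≡v | yes b≡u = inj₂ (a≡v , b≡u)
  ... | no _    | _       | no _   | _      = ⊥-elim (true≢false (sym eq))
  ... | no _    | _       | yes _  | no _   = ⊥-elim (true≢false (sym eq))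
  ... | yes _   | no _    | no _   | _      = ⊥-elim (true≢false (sym eq))
  ... | yes _   | no _    | yes _  | no _   = ⊥-elim (true≢false (sym eq))

  single-⊆ : ∀ {F : Fin n → Fin n → Bool} → (∀ x y → F x y ≡ F y x) → F u v ≡ true →
             ∀ {a b} → single u v a b ≡ true → F a b ≡ true
  single-⊆ Fsym Fuv {a} {b} ab≡uv with single⁻ {a} {b} ab≡uv
  ... | inj₁ (refl , refl) = Fuv
  ... | inj₂ (refl , refl) = trans (Fsym v u) Fuv

  -- xc could only have been deleted if {x, c} = {a, b} = {u, v}; but x = a
  -- contradicts ac surviving and c = a contradicts irreflexivity.
  deleteEdge-nonadj⁻ : ∀ (G : Graph n) {a b c x} → single u v a b ≡ true →
    adj (deleteEdge G u v) a c ≡ true → adj (deleteEdge G u v) x c ≡ false →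
    adj G x c ≡ false
  deleteEdge-nonadj⁻ G {a} {b} {c} {x} ab≡uv ac xc∉G′ = ¬-not xc∉G
    where
    ac∈G : adj G a c ≡ true
    ac∈G = delete-⊆ G (single u v) (single-sym u v) ac
    xc∉G : adj G x c ≢ true
    xc∉G xc
      with single⁻ {a} {b} ab≡uv
         | single⁻ {x} {c} (delete-nonadj⁻ G (single u v) (single-sym u v) xc∉G′ xc)
    ... | inj₁ (refl , refl) | inj₁ (refl , refl) = true≢false (trans (sym ac) xc∉G′)
    ... | inj₂ (refl , refl) | inj₂ (refl , refl) = true≢false (trans (sym ac) xc∉G′)
    ... | inj₁ (refl , refl) | inj₂ (refl , refl) =
          true≢false (trans (sym ac∈G) (adj-irr G a))
    ... | inj₂ (refl , refl) | inj₁ (refl , refl) =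
          true≢false (trans (sym ac∈G) (adj-irr G a))

record Induced2K₂ {n} (G : Graph n) (p q r s : Fin n) : Set where
  constructor induced2K₂
  field
    p~q : adj G p q ≡ true
    r~s : adj G r s ≡ true
    p≁s : adj G p s ≡ false
    r≁q : adj G r q ≡ false
    p≁r : adj G p r ≡ false
    q≁s : adj G q s ≡ false

module ChainGraph {n} (G : Graph n) (X : Fin n → Bool)
  (bipartite : ∀ a b → adj G a b ≡ true → X a ≢ X b)
  (chain : ∀ x y → X x ≡ true → X y ≡ true → NbhdSub G x y ⊎ NbhdSub G y x) where

  X-pair-uncrossed : ∀ {α α′ β β′} → X α ≡ true → X β ≡ true →
    adj G α α′ ≡ true → adj G β β′ ≡ true → adj G α β′ ≡ false → adj G β α′ ≡ false → ⊥
  X-pair-uncrossed {α} {α′} {β} {β′} Xα Xβ αα′ ββ′ αβ′ βα′ with chain α β Xα Xβ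
  ... | inj₁ α⊆β = true≢false (trans (sym (α⊆β α′ αα′)) βα′)
  ... | inj₂ β⊆α = true≢false (trans (sym (β⊆α β′ ββ′)) αβ′)

  no-induced-2K₂ : ∀ {p q r s} → ¬ Induced2K₂ G p q r s
  no-induced-2K₂ (induced2K₂ p~q r~s p≁s r≁q p≁r q≁s)
    with one-side-true (bipartite _ _ p~q) | one-side-true (bipartite _ _ r~s)
  ... | inj₁ Xp | inj₁ Xr = X-pair-uncrossed Xp Xr p~q r~s p≁s r≁q
  ... | inj₂ Xq | inj₁ Xr = X-pair-uncrossed Xq Xr (adj-swap G p~q) r~s q≁s (adj-swap G p≁r)
  ... | inj₁ Xp | inj₂ Xs = X-pair-uncrossed Xp Xs p~q (adj-swap G r~s) p≁r (adj-swap G q≁s)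
  ... | inj₂ Xq | inj₂ Xs =
    X-pair-uncrossed Xq Xs (adj-swap G p~q) (adj-swap G r~s) (adj-swap G r≁q) (adj-swap G p≁s)

  -- On the Y side inclusions go the other way: every neighbour of c lies in X
  -- and, missing c, cannot have a neighbourhood inside N(x).
  Y-nbhdSub : ∀ {x b c} → X x ≡ true → X c ≡ false →
              adj G x b ≡ true → adj G x c ≡ false → NbhdSub G c b
  Y-nbhdSub {x} {b} {c} Xx Xc xb xc y cy
    with chain x y Xx (other-side-true (bipartite c y cy) Xc)
  ... | inj₁ x⊆y = adj-swap G (x⊆y b xb)
  ... | inj₂ y⊆x = ⊥-elim (true≢false (trans (sym (y⊆x c (adj-swap G cy))) xc))

chainGraph⇒2K₂-free : ∀ {n} (G : Graph n) → IsChainGraph G →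
                      ∀ {p q r s} → ¬ Induced2K₂ G p q r s
chainGraph⇒2K₂-free G (X , bipartite , chain) = ChainGraph.no-induced-2K₂ G X bipartite chain

degreeMinimal-opposite-end : ∀ {n} (G : Graph n) {F u v} → DegreeMinimal G F u v →
  ∀ {a b y} → single u v a b ≡ true → F b y ≡ true → deg G a ≤ deg G y
degreeMinimal-opposite-end G (_ , minimal-u , minimal-v) {a} {b} ab≡uv Fby
  with single⁻ {a = a} {b = b} ab≡uv
... | inj₁ (refl , refl) = proj₂ (minimal-u _ _ Fby)
... | inj₂ (refl , refl) = minimal-v _ Fby

module DeletingDegreeMinimalEdge {n} (G : Graph n) (X : Fin n → Bool)
  (bipartite : ∀ a b → adj G a b ≡ true → X a ≢ X b)
  (chain : ∀ x y → X x ≡ true → X y ≡ true → NbhdSub G x y ⊎ NbhdSub G y x)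
  {F : Fin n → Fin n → Bool} (Fsym : ∀ x y → F x y ≡ F y x)
  (G∖F-chain : IsChainGraph (delete G F Fsym))
  {u v : Fin n} (uv-minimal : DegreeMinimal G F u v) where

  private
    G′  = deleteEdge G u v
    G∖F = delete G F Fsym

  deleteEdge-⊆ : ∀ {a b} → adj G′ a b ≡ true → adj G a b ≡ true
  deleteEdge-⊆ = delete-⊆ G (single u v) (single-sym u v)

  no-crossing : ∀ {x a b c} → X x ≡ true → X a ≡ true → NbhdSub G x a →
    adj G′ x b ≡ true → adj G′ a b ≡ false → adj G′ a c ≡ true → adj G′ x c ≡ false → ⊥
  no-crossing {x} {a} {b} {c} Xx Xa x⊆a xb′ ab′ ac′ xc′ =
    chainGraph⇒2K₂-free G∖F G∖F-chain {x} {b} {a} {c} (induced2K₂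
         (delete-adj⁺ G F Fsym xb xb∉F) (delete-adj⁺ G F Fsym ac ac∉F)
         (delete-nonadj G F Fsym xc∉G) (delete-removes G F Fsym (single-⊆ Fsym Fuv ab≡uv))
         (delete-nonadj G F Fsym xa∉G) (delete-nonadj G F Fsym bc∉G))
    where
    open ChainGraph G X bipartite chain
    Fuv : F u v ≡ true
    Fuv = proj₁ uv-minimal
    xb : adj G x b ≡ true
    xb = deleteEdge-⊆ xb′
    ac : adj G a c ≡ true
    ac = deleteEdge-⊆ ac′
    ab≡uv : single u v a b ≡ true
    ab≡uv = delete-nonadj⁻ G (single u v) (single-sym u v) ab′ (x⊆a b xb)
    xc∉G : adj G x c ≡ false
    xc∉G = deleteEdge-nonadj⁻ G ab≡uv ac′ xc′
    Xb : X b ≡ false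
    Xb = other-side-false (bipartite x b xb) Xx
    Xc : X c ≡ false
    Xc = other-side-false (bipartite a c ac) Xa
    xa∉G : adj G x a ≡ false
    xa∉G = ¬-not λ xa → bipartite x a xa (trans Xx (sym Xa))
    bc∉G : adj G b c ≡ false
    bc∉G = ¬-not λ bc → bipartite b c bc (trans Xb (sym Xc))
    x<a : deg G x < deg G a
    x<a = properNbhdSub⇒deg< G x⊆a ac xc∉G
    c<b : deg G c < deg G b
    c<b = properNbhdSub⇒deg< G (Y-nbhdSub Xx Xc xb xc∉G) (adj-swap G xb) (adj-swap G xc∉G)
    xb∉F : F x b ≡ false
    xb∉F = ¬-not λ Fxb →
      <⇒≱ x<a (degreeMinimal-opposite-end G uv-minimal {a} {b} ab≡uv (trans (Fsym b x) Fxb))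
    ba≡uv : single u v b a ≡ true
    ba≡uv = trans (single-sym u v b a) ab≡uv
    ac∉F : F a c ≡ false
    ac∉F = ¬-not λ Fac → <⇒≱ c<b (degreeMinimal-opposite-end G uv-minimal {b} {a} ba≡uv Fac)

  deleteEdge-isChainGraph : IsChainGraph G′
  deleteEdge-isChainGraph = X , (λ a b ab → bipartite a b (deleteEdge-⊆ ab)) , chain′
    where
    chain′ : ∀ x y → X x ≡ true → X y ≡ true → NbhdSub G′ x y ⊎ NbhdSub G′ y x
    chain′ x y Xx Xy = comparable-unless-crossing G′ crossing
      where
      crossing : ∀ {b c} → adj G′ x b ≡ true → adj G′ y b ≡ false →
                           adj G′ y c ≡ true → adj G′ x c ≡ false → ⊥
      crossing xb yb yc xc with chain x y Xx Xy
      ... | inj₁ x⊆y = no-crossing Xx Xy x⊆y xb yb yc xc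
      ... | inj₂ y⊆x = no-crossing Xy Xx y⊆x yc xc xb yb

theorem4p9 : ∀ {n} (G : Graph n) (F : Fin n → Fin n → Bool) (hF : IsEdgeSet G F) →
    IsChainGraph G → IsChainGraph (delete G F (proj₁ hF)) →
    ∀ u v → DegreeMinimal G F u v → IsChainGraph (deleteEdge G u v)
theorem4p9 G F (Fsym , _) (X , bipartite , chain) G∖F-chain u v uv-minimal =
  DeletingDegreeMinimalEdge.deleteEdge-isChainGraph G X bipartite chain Fsym G∖F-chain uv-minimal
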